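{- If $(T,S)\in\mathscr{T}$, then $f_T=(S_A\cup S_C;\emptyset;S_B)$, i.e. the function with $f_T(v)=2$ for $v\in S_B$ and $f_T(v)=0$ otherwise, is the unique $\gamma_R$-function on $T$.
   Context: A Roman dominating function (RDF) on a graph $G$ is a map $f:V(G)\to\{0,1,2\}$ such that every vertex with value $0$ has a neighbor with value $2$; we write $f=(V_0^f;V_1^f;V_2^f)$ with $V_i^f=f^{ -1}(i)$. $\gamma_R(G)$ is the minimum weight $\sum_v f(v)$ of an RDF; a $\gamma_R$-function is an RDF of that weight. A labeling of a tree $T$ is $S:V(T)\to\{A,B,C\}$ (status), and $S_A,S_B,S_C$ are the sets of vertices of each status. A labeled $K_{1,2}$ is a 3-vertex path with leaves of status $A$, center of status $B$. $\mathscr{T}$ is the family of labeled trees obtainable from a sequence $(T_1,S_1),\dots,(T_j,S_j)$, $j\ge1$, with $(T_1,S_1)$ a labeled $K_{1,2}$, $(T,S)=(T_j,S_j)$, each step (keeping old statuses) being one of: O1: add a path $x,y,z$ and edge $ux$, $u\in V(T_i)$ of status $A$ or $C$; $x,z\mapsto A$, $y\mapsto B$. O2: add a star with center $y$, leaves $x,z,t$, and edge $ux$, $u$ of status $B$; $x\mapsto C$, $z,t\mapsto A$, $y\mapsto B$. O3: add a path $x,y,z$ and edge $uy$, $u$ of status $C$; $x,z\mapsto A$, $y\mapsto B$. O4: add a disjoint copy of the labeled tree $R$ (obtained from a labeled $K_{1,2}$ by one application of O2) and edge $ux$, $u\in V(T_i)$ of status $A$ or $C$, $x$ the unique vertex of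 status $C$ in $R$. -}

module Defs where

open import Data.Nat using (ℕ; zero; suc; _+_; _≤_)
open import Data.Fin using (Fin; splitAt; _↑ʳ_)
open import Data.Fin.Patterns
open import Data.Sum using (_⊎_; inj₁; inj₂; [_,_]′)
open import Data.Product using (_×_; ∃; ∃-syntax)
open import Data.List using (List; map)
open import Data.Nat.ListAction using (sum)
open import Data.List using () renaming (tabulate to ltabulate)
open import Data.Empty using (⊥)
open import Data.Unit using (⊤)
open import Relation.Binary.PropositionalEquality using (_≡_)
open import Function.Bundles using (_↔_; _⇔_; Inverse)

data Status : Set where
  A B C : Status

Graph : ℕ → Set₁
Graph n = Fin n → Fin n → Set

Labeling : ℕ → Set
Labeling n = Fin n → Status

-- Disjoint union of a graph on Fin n with a gadget on Fin k (new vertices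
-- are the last k ones), plus one new edge between old vertex u and gadget
-- vertex p.
extG : ∀ {n k} → Graph n → Graph k → Fin n → Fin k → Graph (n + k)
extG {n} E F u p a b with splitAt n a | splitAt n b
... | inj₁ a' | inj₁ b' = E a' b'
... | inj₂ a' | inj₂ b' = F a' b'
... | inj₁ a' | inj₂ b' = (a' ≡ u) × (b' ≡ p)
... | inj₂ a' | inj₁ b' = (b' ≡ u) × (a' ≡ p)

extS : ∀ {n k} → Labeling n → Labeling k → Labeling (n + k)
extS {n} S SF a = [ S , SF ]′ (splitAt n a)

P3 : Graph 3
P3 0F 1F = ⊤
P3 1F 0F = ⊤
P3 1F 2F = ⊤
P3 2F 1F = ⊤
P3 _ _ = ⊥

P3S : Labeling 3
P3S 1F = B
P3S _ = A

-- Star with center y = 0 and leaves x = 1, z = 2, t = 3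
Star : Graph 4
Star 0F 1F = ⊤
Star 1F 0F = ⊤
Star 0F 2F = ⊤
Star 2F 0F = ⊤
Star 0F 3F = ⊤
Star 3F 0F = ⊤
Star _ _ = ⊥

StarS : Labeling 4
StarS 0F = B
StarS 1F = C
StarS _ = A

-- The labeled tree R: labeled K_{1,2} plus one application of O2 at its
-- center (vertex 1, of status B).
RG : Graph 7
RG = extG P3 Star 1F 1F

RS : Labeling 7
RS = extS P3S StarS

-- its unique vertex of status C (the x of the star)
RC : Fin 7
RC = 3 ↑ʳ 1F

AorC : Status → Set
AorC A = ⊤
AorC B = ⊥
AorC C = ⊤

-- The family 𝒯 of labeled trees, closed under relabeling of vertices
-- (labeled trees are considered up to isomorphism).
data 𝒯 : (n : ℕ) → Graph n → Labeling n → Set₁ where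
  base : 𝒯 3 P3 P3S
  O1 : ∀ {n E S} → 𝒯 n E S → (u : Fin n) → AorC (S u) →
       𝒯 (n + 3) (extG E P3 u 0F) (extS S P3S)
  O2 : ∀ {n E S} → 𝒯 n E S → (u : Fin n) → S u ≡ B →
       𝒯 (n + 4) (extG E Star u 1F) (extS S StarS)
  O3 : ∀ {n E S} → 𝒯 n E S → (u : Fin n) → S u ≡ C →
       𝒯 (n + 3) (extG E P3 u 1F) (extS S P3S)
  O4 : ∀ {n E S} → 𝒯 n E S → (u : Fin n) → AorC (S u) →
       𝒯 (n + 7) (extG E RG u RC) (extS S RS)
  iso : ∀ {n E S} → 𝒯 n E S → (E' : Graph n) → (S' : Labeling n) →
        (σ : Fin n ↔ Fin n) →
        (∀ u v → E' u v ⇔ E (Inverse.to σ u) (Inverse.to σ v)) →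
        (∀ v → S' v ≡ S (Inverse.to σ v)) →
        𝒯 n E' S'

weight : ∀ {n} → (Fin n → ℕ) → ℕ
weight {n} f = sum (ltabulate {n = n} f)

IsRDF : ∀ {n} → Graph n → (Fin n → ℕ) → Set
IsRDF {n} E f = (∀ v → f v ≤ 2) × (∀ v → f v ≡ 0 → ∃[ u ] (E v u × f u ≡ 2))

IsGammaRFunction : ∀ {n} → Graph n → (Fin n → ℕ) → Set
IsGammaRFunction {n} E f = IsRDF E f × (∀ g → IsRDF E g → weight f ≤ weight g)

fT : ∀ {n} → Labeling n → Fin n → ℕ
fT S v with S v
... | B = 2
... | _ = 0

-- The induction runs on a stronger statement (RomanRigid): f_T is the unique
-- minimum even among Roman functions that may leave the vertices of status C
-- undominated. Attaching a gadget at u along the edge u p, an RDF h of the new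
-- tree restricts to such relaxed RDFs of the old tree and of the gadget, with
-- one exception: h u = 0, h p = 2, and u is dominated only through p. Then
-- raising h u to 1 repairs the old part, which is now different from f_T and
-- hence strictly heavier, while the gadget part costs strictly more than f_T
-- on the gadget because p carries a 2; so h is too heavy to compete. The
-- facts about the three gadgets are finite checks.
module Submission where

open import Defs
open import Data.Empty using (⊥-elim)
open import Data.Fin using (Fin; zero; suc; splitAt; _↑ˡ_; _↑ʳ_)
open import Data.Fin.Patterns
import Data.Fin.Properties as Fin
open import Data.List.Properties using (tabulate-cong)
open import Data.Nat using (ℕ; zero; suc; _+_; _≤_; _<_; _≤?_; z≤n; s≤s)
open import Data.Nat.ListAction using (sum)
open import Data.Nat.Properties
open import Algebra.Properties.CommutativeMonoid.Sum +-0-commutativeMonoid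
  using (sum-permute) renaming (sum to ∑)
open import Data.Product using (_×_; _,_; proj₁; proj₂; ∃-syntax)
open import Data.Sum using (_⊎_; inj₁; inj₂; [_,_]′)
import Data.Sum as Sum
open import Data.Unit using (tt)
open import Data.Vec.Functional using (_∷_; updateAt)
open import Data.Vec.Functional.Properties using (updateAt-updates; updateAt-minimal)
open import Function using (_∘_; id)
open import Function.Bundles using (_↔_; _⇔_; Inverse; Equivalence)
open import Function.Properties.Inverse using (↔-sym)
open import Relation.Binary.Definitions using (_Respects_)
open import Relation.Binary.PropositionalEquality
open import Relation.Nullary using (Dec; yes; no; contradiction)
open import Relation.Nullary.Decidable using (map′; _×-dec_; _⊎-dec_; _→-dec_; from-yes)

Bounded : ∀ {n} → (Fin n → ℕ) → Set
Bounded h = ∀ v → h v ≤ 2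

DominatesOutside : ∀ {n} → Graph n → (Fin n → Set) → (Fin n → ℕ) → Set
DominatesOutside E Y h = ∀ v → h v ≡ 0 → Y v ⊎ ∃[ u ] (E v u × h u ≡ 2)

IsRDFOutside : ∀ {n} → Graph n → (Fin n → Set) → (Fin n → ℕ) → Set
IsRDFOutside E Y h = Bounded h × DominatesOutside E Y h

LowerBound : ∀ {n} → Graph n → (Fin n → Set) → ℕ → Set
LowerBound E Y w = ∀ h → IsRDFOutside E Y h → w ≤ weight h

LowerBoundAtTwo : ∀ {n} → Graph n → (Fin n → Set) → Fin n → ℕ → Set
LowerBoundAtTwo E Y p w = ∀ h → IsRDFOutside E Y h → h p ≡ 2 → w ≤ weight h

UniqueBelow : ∀ {n} → Graph n → (Fin n → Set) → (Fin n → ℕ) → Set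
UniqueBelow E Y f = ∀ h → IsRDFOutside E Y h → weight h ≤ weight f → h ≗ f

IsC : ∀ {n} → Labeling n → Fin n → Set
IsC S v = S v ≡ C

record RomanRigid {n} (E : Graph n) (S : Labeling n) : Set where
  field
    isRDF      : IsRDF E (fT S)
    lowerBound : LowerBound E (IsC S) (weight (fT S))
    unique     : UniqueBelow E (IsC S) (fT S)

m+n≤o+p⇒p≤n⇒m≤o : ∀ {m n o p} → m + n ≤ o + p → p ≤ n → m ≤ o
m+n≤o+p⇒p≤n⇒m≤o {m} {n} {o} le p≤n =
  +-cancelʳ-≤ n m o (≤-trans le (+-monoʳ-≤ o p≤n))

m+n≤o+p⇒o≤m⇒n≤p : ∀ {m n o p} → m + n ≤ o + p → o ≤ m → n ≤ p
m+n≤o+p⇒o≤m⇒n≤p {m} {n} {o} {p} le o≤m =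
  +-cancelˡ-≤ o n p (≤-trans (+-monoˡ-≤ n o≤m) le)

weight-cong : ∀ {n} {f g : Fin n → ℕ} → f ≗ g → weight f ≡ weight g
weight-cong f≗g = cong sum (tabulate-cong f≗g)

weight-++ : ∀ n k (f : Fin (n + k) → ℕ) →
            weight f ≡ weight (f ∘ (_↑ˡ k)) + weight (f ∘ (n ↑ʳ_))
weight-++ zero    k f = refl
weight-++ (suc n) k f = trans (cong (f zero +_) (weight-++ n k (f ∘ suc)))
                              (sym (+-assoc (f zero) _ _))

weight-permute : ∀ {n} (f : Fin n → ℕ) (σ : Fin n ↔ Fin n) →
                 weight (f ∘ Inverse.to σ) ≡ weight f
weight-permute f σ = begin
  weight (f ∘ Inverse.to σ) ≡⟨ weight≡∑ (f ∘ Inverse.to σ) ⟩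
  ∑ (f ∘ Inverse.to σ)      ≡⟨ sum-permute f σ ⟨
  ∑ f                       ≡⟨ weight≡∑ f ⟨
  weight f                  ∎
  where
  open ≡-Reasoning
  weight≡∑ : ∀ {n} (g : Fin n → ℕ) → weight g ≡ ∑ g
  weight≡∑ {zero}  g = refl
  weight≡∑ {suc n} g = cong (g zero +_) (weight≡∑ (g ∘ suc))

weight-updateAt-suc : ∀ {n} (h : Fin n → ℕ) u → weight (updateAt h u suc) ≡ suc (weight h)
weight-updateAt-suc h zero    = refl
weight-updateAt-suc h (suc u) =
  trans (cong (h zero +_) (weight-updateAt-suc (h ∘ suc) u)) (+-suc (h zero) _)

statusValue : Status → ℕ
statusValue A = 0
statusValue B = 2
statusValue C = 0

fT-statusValue : ∀ {n} (S : Labeling n) v → fT S v ≡ statusValue (S v)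
fT-statusValue S v with S v
... | A = refl
... | B = refl
... | C = refl

fT-cong : ∀ {m n} {S : Labeling m} {S′ : Labeling n} {v w} → S v ≡ S′ w → fT S v ≡ fT S′ w
fT-cong {S = S} {S′} {v} {w} eq =
  trans (fT-statusValue S v) (trans (cong statusValue eq) (sym (fT-statusValue S′ w)))

fT-bounded : ∀ {n} (S : Labeling n) → Bounded (fT S)
fT-bounded S v with S v
... | A = z≤n
... | B = ≤-refl
... | C = z≤n

fT≢1 : ∀ {n} (S : Labeling n) v → fT S v ≢ 1
fT≢1 S v with S v
... | A = λ ()
... | B = λ ()
... | C = λ ()

fT≡2⇒B : ∀ {n} (S : Labeling n) v → fT S v ≡ 2 → S v ≡ B
fT≡2⇒B S v with S v
... | A = λ ()
... | B = λ _ → refl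
... | C = λ ()

IsRDF⇒IsRDFOutside : ∀ {n} {E : Graph n} {Y h} → IsRDF E h → IsRDFOutside E Y h
IsRDF⇒IsRDFOutside (b , d) = b , λ v hv≡0 → inj₂ (d v hv≡0)

IsRDFOutside-mono : ∀ {n} {E : Graph n} {Y Y′ h} → (∀ v → h v ≡ 0 → Y v → Y′ v) →
                    IsRDFOutside E Y h → IsRDFOutside E Y′ h
IsRDFOutside-mono Y⊆Y′ (b , d) = b , λ v hv≡0 → Sum.map₁ (Y⊆Y′ v hv≡0) (d v hv≡0)

IsRDFOutside-raise : ∀ {n} {E : Graph n} {Y u h} → IsRDFOutside E (λ v → Y v ⊎ v ≡ u) h →
                     h u ≡ 0 → IsRDFOutside E Y (updateAt h u suc)
IsRDFOutside-raise {Y = Y} {u} {h} (b , d) hu≡0 = bounded , dominates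
  where
  raised-u : updateAt h u suc u ≡ 1
  raised-u = trans (updateAt-updates u h) (cong suc hu≡0)
  bounded : Bounded (updateAt h u suc)
  bounded v with v Fin.≟ u
  ... | yes refl = subst (_≤ 2) (sym raised-u) (s≤s z≤n)
  ... | no v≢u   = subst (_≤ 2) (sym (updateAt-minimal v u h v≢u)) (b v)
  dominates : DominatesOutside _ Y (updateAt h u suc)
  dominates v zero′ with v Fin.≟ u
  ... | yes refl = contradiction (trans (sym raised-u) zero′) λ ()
  ... | no v≢u with d v (trans (sym (updateAt-minimal v u h v≢u)) zero′)
  ...   | inj₁ (inj₁ y)   = inj₁ y
  ...   | inj₁ (inj₂ v≡u) = contradiction v≡u v≢u
  ...   | inj₂ (w , e , hw≡2) = inj₂ (w , e , trans (updateAt-minimal w u h w≢u) hw≡2)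
    where
    w≢u : w ≢ u
    w≢u refl = 0≢1+n (trans (sym hu≡0) hw≡2)

UniqueBelow⇒< : ∀ {n} {E : Graph n} {Y f g v} → UniqueBelow E Y f → IsRDFOutside E Y g →
                g v ≢ f v → weight f < weight g
UniqueBelow⇒< unique r gv≢fv = ≰⇒> λ g≤f → gv≢fv (unique _ r g≤f _)

≤2-elim : ∀ {P : ℕ → Set} → P 0 → P 1 → P 2 → ∀ {x} → x ≤ 2 → P x
≤2-elim p₀ p₁ p₂ z≤n             = p₀
≤2-elim p₀ p₁ p₂ (s≤s z≤n)       = p₁
≤2-elim p₀ p₁ p₂ (s≤s (s≤s z≤n)) = p₂

∀-bounded? : ∀ k {P : (Fin k → ℕ) → Set} → P Respects _≗_ → (∀ h → Dec (P h)) →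
             Dec (∀ h → Bounded h → P h)
∀-bounded? zero    resp P? = map′ (λ p h _ → resp (λ ()) p) (λ all → all _ λ ()) (P? λ ())
∀-bounded? (suc k) {P} resp P? =
  map′ (λ (p₀ , p₁ , p₂) h b →
         resp (λ { zero → refl ; (suc _) → refl })
              (≤2-elim {λ x → ∀ t → Bounded t → P (x ∷ t)} p₀ p₁ p₂ (b zero) (h ∘ suc) (b ∘ suc)))
       (λ all → headed all z≤n , headed all (s≤s z≤n) , headed all (s≤s (s≤s z≤n)))
       (tails 0 ×-dec tails 1 ×-dec tails 2)
  where
  tails : ∀ x → Dec (∀ t → Bounded t → P (x ∷ t))
  tails x =
    ∀-bounded? k (λ t≗t′ → resp λ { zero → refl ; (suc v) → t≗t′ v }) (P? ∘ (x ∷_))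
  headed : (∀ h → Bounded h → P h) → ∀ {x} → x ≤ 2 → ∀ t → Bounded t → P (x ∷ t)
  headed all x≤2 t b = all _ λ { zero → x≤2 ; (suc v) → b v }

module _ {n} {E : Graph n} {Y : Fin n → Set}
         (E? : ∀ u v → Dec (E u v)) (Y? : ∀ v → Dec (Y v)) where

  private
    dominatesOutside? : ∀ h → Dec (DominatesOutside E Y h)
    dominatesOutside? h =
      Fin.all? λ v → h v ≟ 0 →-dec (Y? v ⊎-dec Fin.any? λ u → E? v u ×-dec h u ≟ 2)

    dominatesOutside-resp : DominatesOutside E Y Respects _≗_
    dominatesOutside-resp f≗g d v gv≡0 with d v (trans (f≗g v) gv≡0)
    ... | inj₁ y              = inj₁ y
    ... | inj₂ (u , e , fu≡2) = inj₂ (u , e , trans (sym (f≗g u)) fu≡2)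

    ∀-RDFOutside? : ∀ {P} → P Respects _≗_ → (∀ h → Dec (P h)) →
                    Dec (∀ h → IsRDFOutside E Y h → P h)
    ∀-RDFOutside? resp P? =
      map′ (λ all h (b , d) → all h b d) (λ all h b d → all h (b , d))
           (∀-bounded? n (λ f≗g q d → resp f≗g (q (dominatesOutside-resp (sym ∘ f≗g) d)))
                         (λ h → dominatesOutside? h →-dec P? h))

  lowerBound? : ∀ w → Dec (LowerBound E Y w)
  lowerBound? w =
    ∀-RDFOutside? (λ f≗g → subst (w ≤_) (weight-cong f≗g)) (λ h → w ≤? weight h)

  lowerBoundAtTwo? : ∀ p w → Dec (LowerBoundAtTwo E Y p w)
  lowerBoundAtTwo? p w =
    ∀-RDFOutside? (λ f≗g q hp≡2 → subst (w ≤_) (weight-cong f≗g) (q (trans (f≗g p) hp≡2)))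
                  (λ h → h p ≟ 2 →-dec w ≤? weight h)

  uniqueBelow? : ∀ f → Dec (UniqueBelow E Y f)
  uniqueBelow? f =
    ∀-RDFOutside? (λ g≗g′ q le v →
                    trans (sym (g≗g′ v)) (q (subst (_≤ weight f) (sym (weight-cong g≗g′)) le) v))
                  (λ h → weight h ≤? weight f →-dec Fin.all? λ v → h v ≟ f v)

data SplitView (n k : ℕ) : Fin (n + k) → Set where
  inˡ : ∀ a → SplitView n k (a ↑ˡ k)
  inʳ : ∀ b → SplitView n k (n ↑ʳ b)

splitView : ∀ n k (v : Fin (n + k)) → SplitView n k v
splitView zero    k v       = inʳ v
splitView (suc n) k zero    = inˡ zero
splitView (suc n) k (suc v) with splitView n k v
... | inˡ a = inˡ (suc a)
... | inʳ b = inʳ b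

≗-split : ∀ {n k} {f g : Fin (n + k) → ℕ} →
          f ∘ (_↑ˡ k) ≗ g ∘ (_↑ˡ k) → f ∘ (n ↑ʳ_) ≗ g ∘ (n ↑ʳ_) → f ≗ g
≗-split {n} {k} eqˡ eqʳ v with splitView n k v
... | inˡ a = eqˡ a
... | inʳ b = eqʳ b

module _ {n k} (E : Graph n) (F : Graph k) (u : Fin n) (p : Fin k) where

  extG-ˡˡ : ∀ a b → extG E F u p (a ↑ˡ k) (b ↑ˡ k) ≡ E a b
  extG-ˡˡ a b rewrite Fin.splitAt-↑ˡ n a k | Fin.splitAt-↑ˡ n b k = refl

  extG-ˡʳ : ∀ a b → extG E F u p (a ↑ˡ k) (n ↑ʳ b) ≡ (a ≡ u × b ≡ p)
  extG-ˡʳ a b rewrite Fin.splitAt-↑ˡ n a k | Fin.splitAt-↑ʳ n k b = refl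

  extG-ʳˡ : ∀ a b → extG E F u p (n ↑ʳ b) (a ↑ˡ k) ≡ (a ≡ u × b ≡ p)
  extG-ʳˡ a b rewrite Fin.splitAt-↑ʳ n k b | Fin.splitAt-↑ˡ n a k = refl

  extG-ʳʳ : ∀ a b → extG E F u p (n ↑ʳ a) (n ↑ʳ b) ≡ F a b
  extG-ʳʳ a b rewrite Fin.splitAt-↑ʳ n k a | Fin.splitAt-↑ʳ n k b = refl

  extG? : (∀ a b → Dec (E a b)) → (∀ a b → Dec (F a b)) → ∀ a b → Dec (extG E F u p a b)
  extG? E? F? a b with splitAt n a | splitAt n b
  ... | inj₁ a′ | inj₁ b′ = E? a′ b′
  ... | inj₂ a′ | inj₂ b′ = F? a′ b′
  ... | inj₁ a′ | inj₂ b′ = a′ Fin.≟ u ×-dec b′ Fin.≟ p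
  ... | inj₂ a′ | inj₁ b′ = b′ Fin.≟ u ×-dec a′ Fin.≟ p

  module _ {Y : Fin (n + k) → Set} {h : Fin (n + k) → ℕ}
           (r : IsRDFOutside (extG E F u p) Y h) where

    restrictˡ : IsRDFOutside E (λ a → Y (a ↑ˡ k) ⊎ (a ≡ u × h (n ↑ʳ p) ≡ 2)) (h ∘ (_↑ˡ k))
    restrictˡ = proj₁ r ∘ (_↑ˡ k) , dominates
      where
      dominates : DominatesOutside E _ (h ∘ (_↑ˡ k))
      dominates a ha≡0 with proj₂ r (a ↑ˡ k) ha≡0
      ... | inj₁ y = inj₁ (inj₁ y)
      ... | inj₂ (w , e , hw≡2) with splitView n k w
      ...   | inˡ a′ = inj₂ (a′ , subst id (extG-ˡˡ a a′) e , hw≡2)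
      ...   | inʳ b with subst id (extG-ˡʳ a b) e
      ...     | refl , refl = inj₁ (inj₂ (refl , hw≡2))

    restrictʳ : IsRDFOutside F (λ b → Y (n ↑ʳ b) ⊎ (b ≡ p × h (u ↑ˡ k) ≡ 2)) (h ∘ (n ↑ʳ_))
    restrictʳ = proj₁ r ∘ (n ↑ʳ_) , dominates
      where
      dominates : DominatesOutside F _ (h ∘ (n ↑ʳ_))
      dominates b hb≡0 with proj₂ r (n ↑ʳ b) hb≡0
      ... | inj₁ y = inj₁ (inj₁ y)
      ... | inj₂ (w , e , hw≡2) with splitView n k w
      ...   | inʳ b′ = inj₂ (b′ , subst id (extG-ʳʳ b b′) e , hw≡2)
      ...   | inˡ a with subst id (extG-ʳˡ a b) e
      ...     | refl , refl = inj₁ (inj₂ (refl , hw≡2))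

module _ {n k} (S : Labeling n) (SF : Labeling k) where

  extS-ˡ : ∀ a → extS S SF (a ↑ˡ k) ≡ S a
  extS-ˡ a rewrite Fin.splitAt-↑ˡ n a k = refl

  extS-ʳ : ∀ b → extS S SF (n ↑ʳ b) ≡ SF b
  extS-ʳ b rewrite Fin.splitAt-↑ʳ n k b = refl

  fT-extS-ˡ : ∀ a → fT (extS S SF) (a ↑ˡ k) ≡ fT S a
  fT-extS-ˡ a = fT-cong {S = extS S SF} {S} (extS-ˡ a)

  fT-extS-ʳ : ∀ b → fT (extS S SF) (n ↑ʳ b) ≡ fT SF b
  fT-extS-ʳ b = fT-cong {S = extS S SF} {SF} (extS-ʳ b)

  weight-fT-extS : weight (fT (extS S SF)) ≡ weight (fT S) + weight (fT SF)
  weight-fT-extS = trans (weight-++ n k (fT (extS S SF)))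
                         (cong₂ _+_ (weight-cong fT-extS-ˡ) (weight-cong fT-extS-ʳ))

module _ {n k} {E : Graph n} {F : Graph k} {S : Labeling n} {SF : Labeling k}
         {u : Fin n} {p : Fin k} where

  fT-isRDF-extG : IsRDF E (fT S) → IsRDF F (fT SF) → IsRDF (extG E F u p) (fT (extS S SF))
  fT-isRDF-extG (_ , dominatesT) (_ , dominatesF) = fT-bounded (extS S SF) , dominates
    where
    dominates : ∀ v → fT (extS S SF) v ≡ 0 → ∃[ w ] (extG E F u p v w × fT (extS S SF) w ≡ 2)
    dominates v fv≡0 with splitView n k v
    ... | inˡ a with dominatesT a (trans (sym (fT-extS-ˡ S SF a)) fv≡0)
    ...   | w , e , fw≡2 =
      w ↑ˡ k , subst id (sym (extG-ˡˡ E F u p a w)) e , trans (fT-extS-ˡ S SF w) fw≡2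
    dominates v fv≡0 | inʳ b with dominatesF b (trans (sym (fT-extS-ʳ S SF b)) fv≡0)
    ...   | w , e , fw≡2 =
      n ↑ʳ w , subst id (sym (extG-ʳʳ E F u p b w)) e , trans (fT-extS-ʳ S SF w) fw≡2

  module _ (rigidT : RomanRigid E S) (rigidF : RomanRigid F SF)
           (lowerBoundF-or-p : LowerBound F (λ b → IsC SF b ⊎ b ≡ p) (weight (fT SF)))
           -- a 2 on u may be what dominates p
           (p-exempt : fT S u ≡ 2 → IsC SF p)
           (u-exempt-or-costly : IsC S u ⊎
                                 LowerBoundAtTwo F (λ b → IsC SF b ⊎ b ≡ p) p (suc (weight (fT SF))))
           where

    private
      module T = RomanRigid rigidT
      module G = RomanRigid rigidF
      E′ = extG E F u p
      S′ = extS S SF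
      wT = weight (fT S)
      wF = weight (fT SF)

    module _ (h : Fin (n + k) → ℕ) (r : IsRDFOutside E′ (IsC S′) h) where

      private
        hˡ = h ∘ (_↑ˡ k)
        hʳ = h ∘ (n ↑ʳ_)
        wˡ = weight hˡ
        wʳ = weight hʳ

      rˡ : IsRDFOutside E (λ a → IsC S a ⊎ (a ≡ u × hʳ p ≡ 2)) hˡ
      rˡ = IsRDFOutside-mono (λ a _ → Sum.map₁ (trans (sym (extS-ˡ S SF a)))) (restrictˡ E F u p r)

      rʳ : IsRDFOutside F (λ b → IsC SF b ⊎ (b ≡ p × hˡ u ≡ 2)) hʳ
      rʳ = IsRDFOutside-mono (λ b _ → Sum.map₁ (trans (sym (extS-ʳ S SF b)))) (restrictʳ E F u p r)

      rʳ-or-p : IsRDFOutside F (λ b → IsC SF b ⊎ b ≡ p) hʳ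
      rʳ-or-p = IsRDFOutside-mono (λ b _ → Sum.map₂ proj₁) rʳ

      wF≤wʳ : wF ≤ wʳ
      wF≤wʳ = lowerBoundF-or-p hʳ rʳ-or-p

      too-heavy : LowerBoundAtTwo F (λ b → IsC SF b ⊎ b ≡ p) p (suc wF) →
                  hˡ u ≡ 0 → hʳ p ≡ 2 → wT + wF < wˡ + wʳ
      too-heavy bump hu≡0 hp≡2 = +-mono-≤-< wT≤wˡ (bump hʳ rʳ-or-p hp≡2)
        where
        raised : IsRDFOutside E (IsC S) (updateAt hˡ u suc)
        raised = IsRDFOutside-raise (IsRDFOutside-mono (λ a _ → Sum.map₂ proj₁) rˡ) hu≡0
        raised-u≢fT : updateAt hˡ u suc u ≢ fT S u
        raised-u≢fT eq = fT≢1 S u (trans (sym eq) (trans (updateAt-updates u hˡ) (cong suc hu≡0)))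
        wT≤wˡ : wT ≤ wˡ
        wT≤wˡ = ≤-pred (subst (wT <_) (weight-updateAt-suc hˡ u)
                              (UniqueBelow⇒< T.unique raised raised-u≢fT))

      tree-part : IsRDFOutside E (IsC S) hˡ ⊎ wT + wF < wˡ + wʳ
      tree-part = [ (λ Su≡C → inj₁ (IsRDFOutside-mono
                      (λ { _ _ (inj₁ c) → c ; _ _ (inj₂ (refl , _)) → Su≡C }) rˡ))
                  , tree-part-bump ]′ u-exempt-or-costly
        where
        tree-part-bump : LowerBoundAtTwo F (λ b → IsC SF b ⊎ b ≡ p) p (suc wF) →
                         IsRDFOutside E (IsC S) hˡ ⊎ wT + wF < wˡ + wʳ
        tree-part-bump bump with hˡ u ≟ 0 | hʳ p ≟ 2
        ... | yes hu≡0 | yes hp≡2 = inj₂ (too-heavy bump hu≡0 hp≡2)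
        ... | no hu≢0  | _        = inj₁ (IsRDFOutside-mono
          (λ { _ _ (inj₁ c) → c ; _ ha≡0 (inj₂ (refl , _)) → contradiction ha≡0 hu≢0 }) rˡ)
        ... | yes _    | no hp≢2  = inj₁ (IsRDFOutside-mono
          (λ { _ _ (inj₁ c) → c ; _ _ (inj₂ (_ , hp≡2)) → contradiction hp≡2 hp≢2 }) rˡ)

      lowerBound′ : wT + wF ≤ wˡ + wʳ
      lowerBound′ = [ (λ good → +-mono-≤ (T.lowerBound hˡ good) wF≤wʳ) , <⇒≤ ]′ tree-part

      unique′ : wˡ + wʳ ≤ wT + wF → h ≗ fT S′
      unique′ le = [ glue , (λ heavy → contradiction le (<⇒≱ heavy)) ]′ tree-part
        where
        glue : IsRDFOutside E (IsC S) hˡ → h ≗ fT S′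
        glue good = ≗-split (λ a → trans (hˡ≗fT a) (sym (fT-extS-ˡ S SF a)))
                            (λ b → trans (hʳ≗fT b) (sym (fT-extS-ʳ S SF b)))
          where
          hˡ≗fT : hˡ ≗ fT S
          hˡ≗fT = T.unique hˡ good (m+n≤o+p⇒p≤n⇒m≤o le wF≤wʳ)
          rʳ-C : IsRDFOutside F (IsC SF) hʳ
          rʳ-C = IsRDFOutside-mono
            (λ { _ _ (inj₁ c) → c
               ; _ _ (inj₂ (refl , hu≡2)) → p-exempt (trans (sym (hˡ≗fT u)) hu≡2) }) rʳ
          hʳ≗fT : hʳ ≗ fT SF
          hʳ≗fT = G.unique hʳ rʳ-C (m+n≤o+p⇒o≤m⇒n≤p le (T.lowerBound hˡ good))

    RomanRigid-extG : RomanRigid E′ S′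
    RomanRigid-extG = record
      { isRDF      = fT-isRDF-extG T.isRDF G.isRDF
      ; lowerBound = λ h r → subst₂ _≤_ (sym (weight-fT-extS S SF)) (sym (weight-++ n k h))
                                         (lowerBound′ h r)
      ; unique     = λ h r le → unique′ h r (subst₂ _≤_ (weight-++ n k h) (weight-fT-extS S SF) le)
      }

module _ {n} {E E′ : Graph n} {S S′ : Labeling n} (σ : Fin n ↔ Fin n)
         (E′⇔E : ∀ u v → E′ u v ⇔ E (Inverse.to σ u) (Inverse.to σ v))
         (S′≡S : ∀ v → S′ v ≡ S (Inverse.to σ v)) (rigid : RomanRigid E S) where

  open Inverse σ using (to; from; strictlyInverseˡ; strictlyInverseʳ)
  private
    module R = RomanRigid rigid

  fT-permute : ∀ v → fT S′ v ≡ fT S (to v)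
  fT-permute v = fT-cong {S = S′} {S} (S′≡S v)

  IsRDFOutside-permute : ∀ {h} → IsRDFOutside E′ (IsC S′) h → IsRDFOutside E (IsC S) (h ∘ from)
  IsRDFOutside-permute {h} (b , d) = b ∘ from , dominates
    where
    dominates : DominatesOutside E (IsC S) (h ∘ from)
    dominates v hv≡0 with d (from v) hv≡0
    ... | inj₁ c =
      inj₁ (trans (sym (cong S (strictlyInverseˡ v))) (trans (sym (S′≡S (from v))) c))
    ... | inj₂ (w , e , hw≡2) =
      inj₂ ( to w
           , subst (λ x → E x (to w)) (strictlyInverseˡ v) (Equivalence.to (E′⇔E (from v) w) e)
           , trans (cong h (strictlyInverseʳ w)) hw≡2)

  fT-isRDF-permute : IsRDF E′ (fT S′)
  fT-isRDF-permute = fT-bounded S′ , dominates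
    where
    dominates : ∀ v → fT S′ v ≡ 0 → ∃[ w ] (E′ v w × fT S′ w ≡ 2)
    dominates v fv≡0 with proj₂ R.isRDF (to v) (trans (sym (fT-permute v)) fv≡0)
    ... | w , e , fw≡2 =
      from w , Equivalence.from (E′⇔E v (from w)) (subst (E (to v)) (sym (strictlyInverseˡ w)) e)
             , trans (fT-permute (from w)) (trans (cong (fT S) (strictlyInverseˡ w)) fw≡2)

  weight-fT-permute : weight (fT S′) ≡ weight (fT S)
  weight-fT-permute = trans (weight-cong fT-permute) (weight-permute (fT S) σ)

  weight-from : ∀ h → weight (h ∘ from) ≡ weight h
  weight-from h = weight-permute h (↔-sym σ)

  RomanRigid-permute : RomanRigid E′ S′
  RomanRigid-permute = record
    { isRDF      = fT-isRDF-permute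
    ; lowerBound = λ h r → subst₂ _≤_ (sym weight-fT-permute) (weight-from h)
                                       (R.lowerBound (h ∘ from) (IsRDFOutside-permute r))
    ; unique     = λ h r le v →
        trans (cong h (sym (strictlyInverseʳ v)))
              (trans (R.unique (h ∘ from) (IsRDFOutside-permute r)
                               (subst₂ _≤_ (sym (weight-from h)) weight-fT-permute le) (to v))
                     (sym (fT-permute v)))
    }

isC? : ∀ s → Dec (s ≡ C)
isC? A = no λ ()
isC? B = no λ ()
isC? C = yes refl

P3? : ∀ u v → Dec (P3 u v)
P3? 0F 0F = no λ ()
P3? 0F 1F = yes tt
P3? 0F 2F = no λ ()
P3? 1F 0F = yes tt
P3? 1F 1F = no λ ()
P3? 1F 2F = yes tt
P3? 2F 0F = no λ ()
P3? 2F 1F = yes tt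
P3? 2F 2F = no λ ()

Star? : ∀ u v → Dec (Star u v)
Star? 0F 0F = no λ ()
Star? 0F 1F = yes tt
Star? 0F 2F = yes tt
Star? 0F 3F = yes tt
Star? 1F 0F = yes tt
Star? 1F 1F = no λ ()
Star? 1F 2F = no λ ()
Star? 1F 3F = no λ ()
Star? 2F 0F = yes tt
Star? 2F 1F = no λ ()
Star? 2F 2F = no λ ()
Star? 2F 3F = no λ ()
Star? 3F 0F = yes tt
Star? 3F 1F = no λ ()
Star? 3F 2F = no λ ()
Star? 3F 3F = no λ ()

RG? : ∀ u v → Dec (RG u v)
RG? = extG? P3 Star 1F 1F P3? Star?

isC-or? : ∀ {k} (S : Labeling k) p b → Dec (IsC S b ⊎ b ≡ p)
isC-or? S p b = isC? (S b) ⊎-dec b Fin.≟ p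

P3-rigid : RomanRigid P3 P3S
P3-rigid = record
  { isRDF      = fT-bounded P3S , λ { 0F _ → 1F , tt , refl ; 2F _ → 1F , tt , refl }
  ; lowerBound = from-yes (lowerBound? P3? (isC? ∘ P3S) 2)
  ; unique     = from-yes (uniqueBelow? P3? (isC? ∘ P3S) (fT P3S))
  }

P3-lowerBound-or : ∀ p → LowerBound P3 (λ b → IsC P3S b ⊎ b ≡ p) 2
P3-lowerBound-or 0F = from-yes (lowerBound? P3? (isC-or? P3S 0F) 2)
P3-lowerBound-or 1F = from-yes (lowerBound? P3? (isC-or? P3S 1F) 2)
P3-lowerBound-or 2F = from-yes (lowerBound? P3? (isC-or? P3S 2F) 2)

P3-lowerBoundAtTwo-leaf : LowerBoundAtTwo P3 (λ b → IsC P3S b ⊎ b ≡ 0F) 0F 3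
P3-lowerBoundAtTwo-leaf = from-yes (lowerBoundAtTwo? P3? (isC-or? P3S 0F) 0F 3)

Star-rigid : RomanRigid Star StarS
Star-rigid = record
  { isRDF      = fT-bounded StarS , λ { 1F _ → 0F , tt , refl ; 2F _ → 0F , tt , refl
                                      ; 3F _ → 0F , tt , refl }
  ; lowerBound = from-yes (lowerBound? Star? (isC? ∘ StarS) 2)
  ; unique     = from-yes (uniqueBelow? Star? (isC? ∘ StarS) (fT StarS))
  }

Star-lowerBound-or : LowerBound Star (λ b → IsC StarS b ⊎ b ≡ 1F) 2
Star-lowerBound-or = from-yes (lowerBound? Star? (isC-or? StarS 1F) 2)

Star-lowerBoundAtTwo : LowerBoundAtTwo Star (λ b → IsC StarS b ⊎ b ≡ 1F) 1F 3
Star-lowerBoundAtTwo = from-yes (lowerBoundAtTwo? Star? (isC-or? StarS 1F) 1F 3)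

R-rigid : RomanRigid RG RS
R-rigid = record
  { isRDF      = fT-bounded RS , λ { 0F _ → 1F , tt , refl ; 2F _ → 1F , tt , refl
                                   ; 4F _ → 3F , tt , refl ; 5F _ → 3F , tt , refl
                                   ; 6F _ → 3F , tt , refl }
  ; lowerBound = from-yes (lowerBound? RG? (isC? ∘ RS) 4)
  ; unique     = from-yes (uniqueBelow? RG? (isC? ∘ RS) (fT RS))
  }

R-lowerBound-or : LowerBound RG (λ b → IsC RS b ⊎ b ≡ RC) 4
R-lowerBound-or = from-yes (lowerBound? RG? (isC-or? RS RC) 4)

R-lowerBoundAtTwo : LowerBoundAtTwo RG (λ b → IsC RS b ⊎ b ≡ RC) RC 5
R-lowerBoundAtTwo = from-yes (lowerBoundAtTwo? RG? (isC-or? RS RC) RC 5)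

AorC-fT≢2 : ∀ {n} (S : Labeling n) u → AorC (S u) → fT S u ≢ 2
AorC-fT≢2 S u ac fu≡2 = subst AorC (fT≡2⇒B S u fu≡2) ac

𝒯⇒RomanRigid : ∀ {n E S} → 𝒯 n E S → RomanRigid E S
𝒯⇒RomanRigid base = P3-rigid
𝒯⇒RomanRigid (O1 {S = S} t u ac) =
  RomanRigid-extG (𝒯⇒RomanRigid t) P3-rigid (P3-lowerBound-or 0F)
                  (⊥-elim ∘ AorC-fT≢2 S u ac) (inj₂ P3-lowerBoundAtTwo-leaf)
𝒯⇒RomanRigid (O2 t u _) =
  RomanRigid-extG (𝒯⇒RomanRigid t) Star-rigid Star-lowerBound-or
                  (λ _ → refl) (inj₂ Star-lowerBoundAtTwo)
𝒯⇒RomanRigid (O3 {S = S} t u Su≡C) =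
  RomanRigid-extG (𝒯⇒RomanRigid t) P3-rigid (P3-lowerBound-or 1F)
                  (⊥-elim ∘ AorC-fT≢2 S u (subst AorC (sym Su≡C) tt)) (inj₁ Su≡C)
𝒯⇒RomanRigid (O4 {S = S} t u ac) =
  RomanRigid-extG (𝒯⇒RomanRigid t) R-rigid R-lowerBound-or
                  (⊥-elim ∘ AorC-fT≢2 S u ac) (inj₂ R-lowerBoundAtTwo)
𝒯⇒RomanRigid (iso t E′ S′ σ E′⇔E S′≡S) =
  RomanRigid-permute σ E′⇔E S′≡S (𝒯⇒RomanRigid t)

mainTheorem11 : ∀ (n : ℕ) (E : Graph n) (S : Labeling n) → 𝒯 n E S →
    IsGammaRFunction E (fT S) ×
    (∀ (g : Fin n → ℕ) → IsGammaRFunction E g → ∀ v → g v ≡ fT S v)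
mainTheorem11 n E S t = (isRDF , minimum) , uniqueness
  where
  open RomanRigid (𝒯⇒RomanRigid t)
  minimum : ∀ g → IsRDF E g → weight (fT S) ≤ weight g
  minimum g g-rdf = lowerBound g (IsRDF⇒IsRDFOutside g-rdf)
  uniqueness : ∀ g → IsGammaRFunction E g → ∀ v → g v ≡ fT S v
  uniqueness g (g-rdf , g-min) = unique g (IsRDF⇒IsRDFOutside g-rdf) (g-min (fT S) isRDF)
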